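{- For all $\mathsf{PTS}\alpha$ terms $t,u$: if $t\to_\beta u$ then $\mathcal A(t)\to_{\mathsf{Bx}'}^+\mathcal A(u)$. (That is, $\mathsf{Bx}'$-reduction strongly simulates $\beta$-reduction through $\mathcal A$.)
   Context: Fix a set $\mathcal S$ of sorts, a denumerable set of variables, and two denumerable sets of meta-variables: term meta-variables $\alpha$ and list meta-variables $\beta$, each with a fixed arity. $\mathsf{PTSC}\alpha$ terms and lists: $M ::= \Pi x^{A}.B \mid \lambda x^{A}.M \mid s \mid x\,l \mid M\,l \mid \langle N/x\rangle_A M \mid \alpha(M_1,\dots,M_n)$, $l ::= [\,] \mid M\cdot l \mid l @ l' \mid \langle N/x\rangle_A l \mid \beta(M_1,\dots,M_n)$ ($\langle N/x\rangle_A$ explicit substitution binding $x$; $\Pi,\lambda$ bind $x$; up to $\alpha$-conversion). Reduction: (B) $(\lambda x^A.M)\,(N\cdot l)\to(\langle N/x\rangle_A M)\,l$; system $\mathsf{x}'$: (B1) $M\,[\,]\to M$; (B2) $(x\,l)\,l'\to x\,(l@l')$; (B3) $(M\,l)\,l'\to M\,(l@l')$; (A1) $(M\cdot l')@l\to M\cdot(l'@l)$; (A2) $[\,]@l\to l$; (A3) $(l@l')@l''\to l@(l'@l'')$; (A4) $l@[\,]\to l$; (C1) $\langle P/y\rangle_G(\lambda x^A.M)\to\lambda x^{\langle P/y\rangle_G A}.\langle P/y\rangle_G M$; (C2) $\langle P/y\rangle_G(y\,l)\to P\,(\langle P/y\rangle_G l)$; (C3) $\langle P/y\rangle_G(x\,l)\to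 x\,(\langle P/y\rangle_G l)$ if $x\neq y$; (C4) $\langle P/y\rangle_G(M\,l)\to(\langle P/y\rangle_G M)\,(\langle P/y\rangle_G l)$; (C5) $\langle P/y\rangle_G(\Pi x^A.B)\to\Pi x^{\langle P/y\rangle_G A}.\langle P/y\rangle_G B$; (C6) $\langle P/y\rangle_G s\to s$; (C$\alpha$) $\langle P/y\rangle_G\alpha(M_1,\dots,M_n)\to\alpha(\langle P/y\rangle_G M_1,\dots)$; (D1) $\langle P/y\rangle_G[\,]\to[\,]$; (D2) $\langle P/y\rangle_G(M\cdot l)\to(\langle P/y\rangle_G M)\cdot(\langle P/y\rangle_G l)$; (D3) $\langle P/y\rangle_G(l@l')\to(\langle P/y\rangle_G l)@(\langle P/y\rangle_G l')$; (D$\beta$) $\langle P/y\rangle_G\beta(M_1,\dots,M_n)\to\beta(\langle P/y\rangle_G M_1,\dots)$. $\to_{\mathsf{Bx}'}$ is the contextual closure of all rules; $\to^+$ its transitive closure. PTS terms $t,u,T ::= x\mid s\mid\Pi x^T.t\mid\lambda x^T.t\mid t\,u$; $\to_\beta$ is the contextual closure of $(\lambda x^v.t)\,u\to t\{x:=u\}$ (capture-avoiding substitution). For each term (resp. list) meta-variable $\alpha$ (resp. $\beta$) of arity $k$ a PTS variable $\alpha^k$ (resp. $\beta^k$) is reserved. $\mathsf{PTS}\alpha$ is the set of PTS terms in which no reserved variable is bound, each $\alpha^k$ is applied to at least $k$ arguments and each $\beta^k$ to at least $k+1$ arguments. Translation $\mathcal A$ from $\mathsf{PTS}\alpha$ to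 $\mathsf{PTSC}\alpha$: $\mathcal A(s)=s$, $\mathcal A(\Pi x^T.U)=\Pi x^{\mathcal A(T)}.\mathcal A(U)$, $\mathcal A(\lambda x^T.t)=\lambda x^{\mathcal A(T)}.\mathcal A(t)$, $\mathcal A(\alpha^k\,t_1\cdots t_k)=\alpha(\mathcal A(t_1),\dots,\mathcal A(t_k))$, $\mathcal A(\beta^k\,t\,t_1\cdots t_k)=\mathcal A_{\beta(\mathcal A(t_1),\dots,\mathcal A(t_k))}(t)$, $\mathcal A(t)=\mathcal A_{[\,]}(t)$ otherwise; $\mathcal A_l(\alpha^k\,t_1\cdots t_k)=\alpha(\mathcal A(t_1),\dots,\mathcal A(t_k))\,l$, $\mathcal A_l(\beta^k\,t\,t_1\cdots t_k)=\mathcal A_{\beta(\mathcal A(t_1),\dots,\mathcal A(t_k))@l}(t)$, $\mathcal A_l(t\,u)=\mathcal A_{\mathcal A(u)\cdot l}(t)$ otherwise, $\mathcal A_l(x)=x\,l$, $\mathcal A_l(t)=\mathcal A(t)\,l$ otherwise (in the displayed $\alpha^k$, $\beta^k$ cases the reserved variable is applied to exactly $k$, resp. $k+1$, arguments). -}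

module Defs where

-- Syntax is represented with (unscoped) de Bruijn indices, so terms are
-- identified up to alpha-conversion by construction.

open import Data.Nat using (ℕ; zero; suc; _≤_)
open import Data.Unit using (⊤)
open import Data.Product using (_×_; _,_; proj₁; proj₂)
open import Data.List using (List; []; _∷_; map)
open import Data.Maybe using (Maybe; nothing; just)
open import Data.Vec as V using (Vec)
open import Relation.Binary.Construct.Closure.Transitive using (TransClosure)

record Sig : Set₁ where
  field
    Sort : Set
    MA   : Set          -- term meta-variables α
    arA  : MA → ℕ
    MB   : Set          -- list meta-variables β
    arB  : MB → ℕ

module _ {σ : Sig} where
  open Sig σ

  infixl 5 _·ₗ_
  infixr 6 _∷ₗ_
  infixr 5 _++ₗ_

  mutual
    data CTm : Set where
      Πc   : CTm → CTm → CTm            -- Π x^A . B   (B under binder)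
      λc   : CTm → CTm → CTm            -- λ x^A . M   (M under binder)
      sc   : Sort → CTm
      _⟨_⟩ : ℕ → CList → CTm
      _·ₗ_ : CTm → CList → CTm
      esub : CTm → CTm → CTm → CTm      -- esub N A M = ⟨N/x⟩_A M (M under binder)
      mα   : (a : MA) → Vec CTm (arA a) → CTm

    data CList : Set where
      []ₗ   : CList
      _∷ₗ_  : CTm → CList → CList
      _++ₗ_   : CList → CList → CList
      esubl : CTm → CTm → CList → CList  -- ⟨N/x⟩_A l (l under binder)
      mβ    : (b : MB) → Vec CTm (arB b) → CList

  -- renaming of PTSC terms (used only to express alpha-conversion in C1/C5)
  liftR : (ℕ → ℕ) → ℕ → ℕ
  liftR ρ zero    = zero
  liftR ρ (suc n) = suc (ρ n)

  mutual
    renC : (ℕ → ℕ) → CTm → CTm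
    renC ρ (Πc A B)     = Πc (renC ρ A) (renC (liftR ρ) B)
    renC ρ (λc A M)     = λc (renC ρ A) (renC (liftR ρ) M)
    renC ρ (sc s)       = sc s
    renC ρ (x ⟨ l ⟩)    = ρ x ⟨ renL ρ l ⟩
    renC ρ (M ·ₗ l)     = renC ρ M ·ₗ renL ρ l
    renC ρ (esub N A M) = esub (renC ρ N) (renC ρ A) (renC (liftR ρ) M)
    renC ρ (mα a Ms)    = mα a (renV ρ Ms)

    renL : (ℕ → ℕ) → CList → CList
    renL ρ []ₗ           = []ₗ
    renL ρ (M ∷ₗ l)      = renC ρ M ∷ₗ renL ρ l
    renL ρ (l ++ₗ l')      = renL ρ l ++ₗ renL ρ l'
    renL ρ (esubl N A l) = esubl (renC ρ N) (renC ρ A) (renL (liftR ρ) l)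
    renL ρ (mβ b Ms)     = mβ b (renV ρ Ms)

    renV : ∀ {n} → (ℕ → ℕ) → Vec CTm n → Vec CTm n
    renV ρ V.[]       = V.[]
    renV ρ (M V.∷ Ms) = renC ρ M V.∷ renV ρ Ms

  ↑ : CTm → CTm
  ↑ = renC suc

  swap01 : ℕ → ℕ
  swap01 zero          = suc zero
  swap01 (suc zero)    = zero
  swap01 (suc (suc n)) = suc (suc n)

  swap : CTm → CTm
  swap = renC swap01

  infix 4 _⟶_ _⟶ₗ_ _⟶ᵥ_

  mutual
    data _⟶_ : CTm → CTm → Set where
      B   : ∀ {A M N l} → λc A M ·ₗ (N ∷ₗ l) ⟶ esub N A M ·ₗ l
      B1  : ∀ {M} → M ·ₗ []ₗ ⟶ M
      B2  : ∀ {x l l'} → (x ⟨ l ⟩) ·ₗ l' ⟶ x ⟨ l ++ₗ l' ⟩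
      B3  : ∀ {M l l'} → (M ·ₗ l) ·ₗ l' ⟶ M ·ₗ (l ++ₗ l')
      -- ⟨P/y⟩_G (λx^A.M) → λx^{⟨P/y⟩_G A}.⟨P/y⟩_G M   (x fresh)
      C1  : ∀ {P G A M} → esub P G (λc A M) ⟶ λc (esub P G A) (esub (↑ P) (↑ G) (swap M))
      C2  : ∀ {P G l} → esub P G (zero ⟨ l ⟩) ⟶ P ·ₗ esubl P G l
      C3  : ∀ {P G x l} → esub P G (suc x ⟨ l ⟩) ⟶ x ⟨ esubl P G l ⟩
      C4  : ∀ {P G M l} → esub P G (M ·ₗ l) ⟶ esub P G M ·ₗ esubl P G l
      C5  : ∀ {P G A B'} → esub P G (Πc A B') ⟶ Πc (esub P G A) (esub (↑ P) (↑ G) (swap B'))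
      C6  : ∀ {P G s} → esub P G (sc s) ⟶ sc s
      Cα  : ∀ {P G a Ms} → esub P G (mα a Ms) ⟶ mα a (V.map (esub P G) Ms)
      Πc₁   : ∀ {A A' B'} → A ⟶ A' → Πc A B' ⟶ Πc A' B'
      Πc₂   : ∀ {A B' B''} → B' ⟶ B'' → Πc A B' ⟶ Πc A B''
      λc₁   : ∀ {A A' M} → A ⟶ A' → λc A M ⟶ λc A' M
      λc₂   : ∀ {A M M'} → M ⟶ M' → λc A M ⟶ λc A M'
      var₁  : ∀ {x l l'} → l ⟶ₗ l' → x ⟨ l ⟩ ⟶ x ⟨ l' ⟩
      app₁  : ∀ {M M' l} → M ⟶ M' → M ·ₗ l ⟶ M' ·ₗ l
      app₂  : ∀ {M l l'} → l ⟶ₗ l' → M ·ₗ l ⟶ M ·ₗ l'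
      esub₁ : ∀ {N N' A M} → N ⟶ N' → esub N A M ⟶ esub N' A M
      esub₂ : ∀ {N A A' M} → A ⟶ A' → esub N A M ⟶ esub N A' M
      esub₃ : ∀ {N A M M'} → M ⟶ M' → esub N A M ⟶ esub N A M'
      mα₁   : ∀ {a Ms Ms'} → Ms ⟶ᵥ Ms' → mα a Ms ⟶ mα a Ms'

    data _⟶ₗ_ : CList → CList → Set where
      A1  : ∀ {M l' l} → (M ∷ₗ l') ++ₗ l ⟶ₗ M ∷ₗ (l' ++ₗ l)
      A2  : ∀ {l} → []ₗ ++ₗ l ⟶ₗ l
      A3  : ∀ {l l' l''} → (l ++ₗ l') ++ₗ l'' ⟶ₗ l ++ₗ (l' ++ₗ l'')
      A4  : ∀ {l} → l ++ₗ []ₗ ⟶ₗ l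
      D1  : ∀ {P G} → esubl P G []ₗ ⟶ₗ []ₗ
      D2  : ∀ {P G M l} → esubl P G (M ∷ₗ l) ⟶ₗ esub P G M ∷ₗ esubl P G l
      D3  : ∀ {P G l l'} → esubl P G (l ++ₗ l') ⟶ₗ esubl P G l ++ₗ esubl P G l'
      Dβ  : ∀ {P G b Ms} → esubl P G (mβ b Ms) ⟶ₗ mβ b (V.map (esub P G) Ms)
      cons₁  : ∀ {M M' l} → M ⟶ M' → M ∷ₗ l ⟶ₗ M' ∷ₗ l
      cons₂  : ∀ {M l l'} → l ⟶ₗ l' → M ∷ₗ l ⟶ₗ M ∷ₗ l'
      cat₁   : ∀ {l₁ l₁' l₂} → l₁ ⟶ₗ l₁' → l₁ ++ₗ l₂ ⟶ₗ l₁' ++ₗ l₂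
      cat₂   : ∀ {l₁ l₂ l₂'} → l₂ ⟶ₗ l₂' → l₁ ++ₗ l₂ ⟶ₗ l₁ ++ₗ l₂'
      esubl₁ : ∀ {N N' A l} → N ⟶ N' → esubl N A l ⟶ₗ esubl N' A l
      esubl₂ : ∀ {N A A' l} → A ⟶ A' → esubl N A l ⟶ₗ esubl N A' l
      esubl₃ : ∀ {N A l l'} → l ⟶ₗ l' → esubl N A l ⟶ₗ esubl N A l'
      mβ₁    : ∀ {b Ms Ms'} → Ms ⟶ᵥ Ms' → mβ b Ms ⟶ₗ mβ b Ms'

    data _⟶ᵥ_ : ∀ {n} → Vec CTm n → Vec CTm n → Set where
      here  : ∀ {n M M'} {Ms : Vec CTm n} → M ⟶ M' → (M V.∷ Ms) ⟶ᵥ (M' V.∷ Ms)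
      there : ∀ {n M} {Ms Ms' : Vec CTm n} → Ms ⟶ᵥ Ms' → (M V.∷ Ms) ⟶ᵥ (M V.∷ Ms')

  infix 4 _⟶⁺_
  _⟶⁺_ : CTm → CTm → Set
  _⟶⁺_ = TransClosure _⟶_

  -- PTS terms (with the reserved variables α^k, β^k as separate
  -- free-variable constructors, so they can never be bound)
  infixl 7 _·_
  data Tm : Set where
    var : ℕ → Tm
    srt : Sort → Tm
    Π   : Tm → Tm → Tm      -- Π x^T . U  (U under binder)
    ƛ   : Tm → Tm → Tm      -- λ x^T . t  (t under binder)
    _·_ : Tm → Tm → Tm
    rα  : MA → Tm           -- reserved variable α^k (k = arA a)
    rβ  : MB → Tm           -- reserved variable β^k (k = arB b)

  ext : (ℕ → ℕ) → ℕ → ℕ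
  ext = liftR

  ren : (ℕ → ℕ) → Tm → Tm
  ren ρ (var x)  = var (ρ x)
  ren ρ (srt s)  = srt s
  ren ρ (Π T U)  = Π (ren ρ T) (ren (ext ρ) U)
  ren ρ (ƛ T t)  = ƛ (ren ρ T) (ren (ext ρ) t)
  ren ρ (t · u)  = ren ρ t · ren ρ u
  ren ρ (rα a)   = rα a
  ren ρ (rβ b)   = rβ b

  exts : (ℕ → Tm) → ℕ → Tm
  exts θ zero    = var zero
  exts θ (suc n) = ren suc (θ n)

  subst : (ℕ → Tm) → Tm → Tm
  subst θ (var x) = θ x
  subst θ (srt s) = srt s
  subst θ (Π T U) = Π (subst θ T) (subst (exts θ) U)
  subst θ (ƛ T t) = ƛ (subst θ T) (subst (exts θ) t)
  subst θ (t · u) = subst θ t · subst θ u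
  subst θ (rα a)  = rα a
  subst θ (rβ b)  = rβ b

  single : Tm → ℕ → Tm
  single u zero    = u
  single u (suc n) = var n

  -- t{x:=u} where x is the variable bound at index 0
  _[_] : Tm → Tm → Tm
  t [ u ] = subst (single u) t

  infix 4 _→β_
  data _→β_ : Tm → Tm → Set where
    β    : ∀ {v t u} → ƛ v t · u →β t [ u ]
    Π₁   : ∀ {T T' U} → T →β T' → Π T U →β Π T' U
    Π₂   : ∀ {T U U'} → U →β U' → Π T U →β Π T U'
    ƛ₁   : ∀ {T T' t} → T →β T' → ƛ T t →β ƛ T' t
    ƛ₂   : ∀ {T t t'} → t →β t' → ƛ T t →β ƛ T t'
    app₁ : ∀ {t t' u} → t →β t' → t · u →β t' · u
    app₂ : ∀ {t u u'} → u →β u' → t · u →β t · u'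

  -- PTSα: each α^k applied to at least k, each β^k to at least k+1 arguments.
  -- ArgsOK n t : the occurrence t, which is applied to n arguments, is fine.
  ArgsOK : ℕ → Tm → Set
  ArgsOK n (var x) = ⊤
  ArgsOK n (srt s) = ⊤
  ArgsOK n (Π T U) = ArgsOK 0 T × ArgsOK 0 U
  ArgsOK n (ƛ T t) = ArgsOK 0 T × ArgsOK 0 t
  ArgsOK n (t · u) = ArgsOK (suc n) t × ArgsOK 0 u
  ArgsOK n (rα a)  = arA a ≤ n
  ArgsOK n (rβ b)  = suc (arB b) ≤ n

  PTSα : Tm → Set
  PTSα t = ArgsOK 0 t

  -- Translation 𝒜 : PTSα → PTSCα  (and 𝒜_l)
  -- The clauses of 𝒜 / 𝒜_l are implemented by walking down the
  -- application spine.  Each argument already passed is remembered both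
  -- as 𝒜(a) and as the function L ↦ 𝒜_L(a).  The context is
  -- `nothing` for 𝒜(_) and `just l` for 𝒜_l(_).

  close : Maybe CList → CList
  close nothing  = []ₗ
  close (just l) = l

  -- pushing translated arguments M1 … Mn in front of the context:
  -- the context list becomes M1 · … · Mn · l  (or M1·…·Mn·[] at top level)
  pushArgs : List CTm → Maybe CList → Maybe CList
  pushArgs []       m = m
  pushArgs (M ∷ Ms) m = just (M ∷ₗ close (pushArgs Ms m))

  applyM : CTm → Maybe CList → CTm
  applyM M nothing  = M
  applyM M (just l) = M ·ₗ l

  takeV : (k : ℕ) → List CTm → Maybe (Vec CTm k × List CTm)
  takeV zero    Ms       = just (V.[] , Ms)
  takeV (suc k) []       = nothing
  takeV (suc k) (M ∷ Ms) with takeV k Ms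
  ... | nothing          = nothing
  ... | just (Ns , rest) = just (M V.∷ Ns , rest)

  βctx : CList → Maybe CList → CList
  βctx L nothing  = L
  βctx L (just l) = L ++ₗ l

  -- junk value for terms outside PTSα (never used on PTSα terms)
  junk : CTm
  junk = zero ⟨ []ₗ ⟩

  Arg : Set
  Arg = CTm × (CList → CTm)

  mutual
    𝒜 : Tm → CTm
    𝒜 t = tr t [] nothing

    𝒜ₗ : CList → Tm → CTm
    𝒜ₗ l t = tr t [] (just l)

    -- tr t [a1,…,an] m  translates  t a1 … an  in context m
    tr : Tm → List Arg → Maybe CList → CTm
    tr (t · u) as m = tr t ((𝒜 u , λ L → 𝒜ₗ L u) ∷ as) m
    tr (var x) as m = x ⟨ close (pushArgs (map proj₁ as) m) ⟩
    tr (srt s) as m = applyM (sc s) (pushArgs (map proj₁ as) m)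
    tr (Π T U) as m = applyM (Πc (𝒜 T) (𝒜 U)) (pushArgs (map proj₁ as) m)
    tr (ƛ T t) as m = applyM (λc (𝒜 T) (𝒜 t)) (pushArgs (map proj₁ as) m)
    tr (rα a)  as m with takeV (Sig.arA σ a) (map proj₁ as)
    ... | nothing         = junk
    ... | just (Ms , rest) = applyM (mα a Ms) (pushArgs rest m)
    tr (rβ b)  []             m = junk
    tr (rβ b)  ((_ , f) ∷ as) m with takeV (Sig.arB σ b) (map proj₁ as)
    ... | nothing          = junk
    ... | just (Ms , rest) = f (βctx (mβ b Ms) (pushArgs rest m))

module Submission where

-- 𝒜 = tr _ [] nothing walks down the application spine, so every property
-- of 𝒜 is proved for tr t (args us) m: the term t applied to extra arguments
-- us, in a context m (none, or a list as in 𝒜ₗ).  Head meta-variables α, β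
-- consume a prefix of the arguments via takeV; PTSα guarantees the prefix
-- exists.  Facts about the arguments are carried as induction hypotheses in All.

open import Defs
open import Data.Nat using (ℕ; zero; suc; _≤_; z≤n; s≤s)
open import Data.Nat.Properties using (≤-trans)
open import Data.Unit using (tt)
open import Data.Empty using (⊥; ⊥-elim)
open import Data.Product using (_×_; _,_; proj₁; Σ)
open import Data.Sum using (_⊎_; inj₁; inj₂)
open import Data.List using (List; []; _∷_; map; _++_; length)
open import Data.List.Properties using (length-map)
open import Data.List.Relation.Unary.All using (All; []; _∷_)
open import Data.List.Relation.Binary.Pointwise using (Pointwise; []; _∷_)
open import Data.Vec as V using (Vec)
open import Data.Vec.Relation.Binary.Pointwise.Inductive as Vecʷ using ([]; _∷_)
open import Data.Maybe using (Maybe; nothing; just)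
open import Function using (_∘_)
open import Relation.Binary.PropositionalEquality
  using (_≡_; refl; sym; trans; cong; cong₂; subst₂; _≗_)
import Relation.Binary.PropositionalEquality as Eq
open import Relation.Binary.Construct.Closure.ReflexiveTransitive
  using (Star; ε; _◅_; _◅◅_; gmap; return)
open import Relation.Binary.Construct.Closure.Transitive
  using (TransClosure; _∷_) renaming ([_] to [_]⁺; _++_ to _⁺++_)

⁺gmap : {A B : Set} {R : A → A → Set} {S : B → B → Set} (f : A → B) →
        (∀ {x y} → R x y → S (f x) (f y)) →
        ∀ {x y} → TransClosure R x y → TransClosure S (f x) (f y)
⁺gmap f g [ r ]⁺   = [ g r ]⁺
⁺gmap f g (r ∷ rs) = g r ∷ ⁺gmap f g rs

module _ {A : Set} {R : A → A → Set} where

  ⁺⇒⋆ : ∀ {a b} → TransClosure R a b → Star R a b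
  ⁺⇒⋆ [ r ]⁺   = return r
  ⁺⇒⋆ (r ∷ rs) = r ◅ ⁺⇒⋆ rs

  infixr 5 _◅⁺_
  _◅⁺_ : ∀ {a b c} → R a b → Star R b c → TransClosure R a c
  r ◅⁺ ε        = [ r ]⁺
  r ◅⁺ (s ◅ ss) = r ∷ (s ◅⁺ ss)

module _ {σ : Sig} where
  open Sig σ

  Term : Set
  Term = Tm {σ}

  CTerm : Set
  CTerm = CTm {σ}

  CLst : Set
  CLst = CList {σ}

  infix 4 _⟶⋆_ _⟶ₗ⋆_ _⟶ₗ⁺_
  _⟶⋆_ : CTerm → CTerm → Set
  _⟶⋆_ = Star _⟶_

  _⟶ₗ⋆_ : CLst → CLst → Set
  _⟶ₗ⋆_ = Star _⟶ₗ_

  _⟶ₗ⁺_ : CLst → CLst → Set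
  _⟶ₗ⁺_ = TransClosure _⟶ₗ_

  -- Renaming and substitution of PTS terms

  -- Renaming under a binder and exchange of the two innermost variables,
  -- specialised to σ (their types in Defs do not determine σ).
  extR : (ℕ → ℕ) → ℕ → ℕ
  extR = ext {σ}

  swap₀₁ : ℕ → ℕ
  swap₀₁ = swap01 {σ}

  ext-cong : ∀ {ρ ρ' : ℕ → ℕ} → ρ ≗ ρ' → extR ρ ≗ extR ρ'
  ext-cong e zero    = refl
  ext-cong e (suc x) = cong suc (e x)

  ren-cong : ∀ {ρ ρ'} → ρ ≗ ρ' → (t : Term) → ren ρ t ≡ ren ρ' t
  ren-cong e (var x) = cong var (e x)
  ren-cong e (srt s) = refl
  ren-cong e (Π T U) = cong₂ Π (ren-cong e T) (ren-cong (ext-cong e) U)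
  ren-cong e (ƛ T U) = cong₂ ƛ (ren-cong e T) (ren-cong (ext-cong e) U)
  ren-cong e (t · u) = cong₂ _·_ (ren-cong e t) (ren-cong e u)
  ren-cong e (rα a)  = refl
  ren-cong e (rβ b)  = refl

  ext-∘ : ∀ (ρ ρ' : ℕ → ℕ) → extR ρ ∘ extR ρ' ≗ extR (ρ ∘ ρ')
  ext-∘ ρ ρ' zero    = refl
  ext-∘ ρ ρ' (suc x) = refl

  ren-∘ : ∀ ρ ρ' (t : Term) → ren ρ (ren ρ' t) ≡ ren (ρ ∘ ρ') t
  ren-∘ ρ ρ' (var x) = refl
  ren-∘ ρ ρ' (srt s) = refl
  ren-∘ ρ ρ' (Π T U) =
    cong₂ Π (ren-∘ ρ ρ' T) (trans (ren-∘ (extR ρ) (extR ρ') U) (ren-cong (ext-∘ ρ ρ') U))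
  ren-∘ ρ ρ' (ƛ T U) =
    cong₂ ƛ (ren-∘ ρ ρ' T) (trans (ren-∘ (extR ρ) (extR ρ') U) (ren-cong (ext-∘ ρ ρ') U))
  ren-∘ ρ ρ' (t · u) = cong₂ _·_ (ren-∘ ρ ρ' t) (ren-∘ ρ ρ' u)
  ren-∘ ρ ρ' (rα a)  = refl
  ren-∘ ρ ρ' (rβ b)  = refl

  ext-id : extR (λ x → x) ≗ (λ x → x)
  ext-id zero    = refl
  ext-id (suc x) = refl

  ren-id : (t : Term) → ren (λ x → x) t ≡ t
  ren-id (var x) = refl
  ren-id (srt s) = refl
  ren-id (Π T U) = cong₂ Π (ren-id T) (trans (ren-cong ext-id U) (ren-id U))
  ren-id (ƛ T U) = cong₂ ƛ (ren-id T) (trans (ren-cong ext-id U) (ren-id U))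
  ren-id (t · u) = cong₂ _·_ (ren-id t) (ren-id u)
  ren-id (rα a)  = refl
  ren-id (rβ b)  = refl

  exts-cong : ∀ {θ θ' : ℕ → Term} → θ ≗ θ' → exts θ ≗ exts θ'
  exts-cong e zero    = refl
  exts-cong e (suc x) = cong (ren suc) (e x)

  subst-cong : ∀ {θ θ'} → θ ≗ θ' → (t : Term) → subst θ t ≡ subst θ' t
  subst-cong e (var x) = e x
  subst-cong e (srt s) = refl
  subst-cong e (Π T U) = cong₂ Π (subst-cong e T) (subst-cong (exts-cong e) U)
  subst-cong e (ƛ T U) = cong₂ ƛ (subst-cong e T) (subst-cong (exts-cong e) U)
  subst-cong e (t · u) = cong₂ _·_ (subst-cong e t) (subst-cong e u)
  subst-cong e (rα a)  = refl
  subst-cong e (rβ b)  = refl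

  exts-ext : ∀ (θ : ℕ → Term) ρ → exts θ ∘ extR ρ ≗ exts (θ ∘ ρ)
  exts-ext θ ρ zero    = refl
  exts-ext θ ρ (suc x) = refl

  subst-ren : ∀ θ ρ (t : Term) → subst θ (ren ρ t) ≡ subst (θ ∘ ρ) t
  subst-ren θ ρ (var x) = refl
  subst-ren θ ρ (srt s) = refl
  subst-ren θ ρ (Π T U) =
    cong₂ Π (subst-ren θ ρ T) (trans (subst-ren (exts θ) (extR ρ) U) (subst-cong (exts-ext θ ρ) U))
  subst-ren θ ρ (ƛ T U) =
    cong₂ ƛ (subst-ren θ ρ T) (trans (subst-ren (exts θ) (extR ρ) U) (subst-cong (exts-ext θ ρ) U))
  subst-ren θ ρ (t · u) = cong₂ _·_ (subst-ren θ ρ t) (subst-ren θ ρ u)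
  subst-ren θ ρ (rα a)  = refl
  subst-ren θ ρ (rβ b)  = refl

  -- This is the PTS counterpart of the variable exchange in rules C1/C5.
  subst-swap : ∀ ρ (w t : Term) →
    subst (single (ren suc w)) (ren (swap₀₁ ∘ extR ρ) t) ≡ subst (exts (single w)) (ren (extR ρ) t)
  subst-swap ρ w t =
    trans (subst-ren _ _ t) (trans (subst-cong pointwise t) (sym (subst-ren _ _ t)))
    where
    pointwise : single (ren suc w) ∘ swap₀₁ ∘ extR ρ ≗ exts (single w) ∘ extR ρ
    pointwise zero = refl
    pointwise (suc x) with ρ x
    ... | zero  = refl
    ... | suc y = refl

  ArgsOK-mono : ∀ {n n'} (t : Term) → n ≤ n' → ArgsOK n t → ArgsOK n' t
  ArgsOK-mono (var x) le o             = o
  ArgsOK-mono (srt s) le o             = o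
  ArgsOK-mono (Π T U) le o             = o
  ArgsOK-mono (ƛ T U) le o             = o
  ArgsOK-mono (t · u) le (ot , ou)     = ArgsOK-mono t (s≤s le) ot , ou
  ArgsOK-mono (rα a)  le o             = ≤-trans o le
  ArgsOK-mono (rβ b)  le o             = ≤-trans o le

  ArgsOK-ren : ∀ {n} ρ (t : Term) → ArgsOK n t → ArgsOK n (ren ρ t)
  ArgsOK-ren ρ (var x) o         = o
  ArgsOK-ren ρ (srt s) o         = o
  ArgsOK-ren ρ (Π T U) (oT , oU) = ArgsOK-ren ρ T oT , ArgsOK-ren (extR ρ) U oU
  ArgsOK-ren ρ (ƛ T U) (oT , oU) = ArgsOK-ren ρ T oT , ArgsOK-ren (extR ρ) U oU
  ArgsOK-ren ρ (t · u) (ot , ou) = ArgsOK-ren ρ t ot , ArgsOK-ren ρ u ou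
  ArgsOK-ren ρ (rα a)  o         = o
  ArgsOK-ren ρ (rβ b)  o         = o

  OKSubst : (ℕ → Term) → Set
  OKSubst θ = ∀ x → PTSα (θ x)

  exts-OK : ∀ {θ} → OKSubst θ → OKSubst (exts θ)
  exts-OK h zero    = tt
  exts-OK h (suc x) = ArgsOK-ren suc _ (h x)

  single-OK : ∀ {w : Term} → PTSα w → OKSubst (single w)
  single-OK o zero    = o
  single-OK o (suc x) = tt

  ArgsOK-subst : ∀ {n θ} → OKSubst θ → (t : Term) → ArgsOK n t → ArgsOK n (subst θ t)
  ArgsOK-subst {θ = θ} h (var x) o = ArgsOK-mono (θ x) z≤n (h x)
  ArgsOK-subst h (srt s) o         = o
  ArgsOK-subst h (Π T U) (oT , oU) = ArgsOK-subst h T oT , ArgsOK-subst (exts-OK h) U oU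
  ArgsOK-subst h (ƛ T U) (oT , oU) = ArgsOK-subst h T oT , ArgsOK-subst (exts-OK h) U oU
  ArgsOK-subst h (t · u) (ot , ou) = ArgsOK-subst h t ot , ArgsOK-subst h u ou
  ArgsOK-subst h (rα a)  o         = o
  ArgsOK-subst h (rβ b)  o         = o

  arg : Term → Arg {σ}
  arg u = 𝒜 u , λ L → 𝒜ₗ L u

  args : List Term → List (Arg {σ})
  args = map arg

  𝒜s : List Term → List CTerm
  𝒜s us = map proj₁ (args us)

  𝒜s-++ : ∀ as us → 𝒜s (as ++ us) ≡ 𝒜s as ++ 𝒜s us
  𝒜s-++ []       us = refl
  𝒜s-++ (a ∷ as) us = cong (𝒜 a ∷_) (𝒜s-++ as us)

  infixr 6 _∷∷_
  _∷∷_ : List CTerm → CLst → CLst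
  []       ∷∷ L = L
  (M ∷ Ms) ∷∷ L = M ∷ₗ (Ms ∷∷ L)

  ∷∷-++ : ∀ (Ms Ns : List CTerm) L → (Ms ++ Ns) ∷∷ L ≡ Ms ∷∷ (Ns ∷∷ L)
  ∷∷-++ []       Ns L = refl
  ∷∷-++ (M ∷ Ms) Ns L = cong (M ∷ₗ_) (∷∷-++ Ms Ns L)

  close-push : ∀ (Ms : List CTerm) m → close (pushArgs Ms m) ≡ Ms ∷∷ close m
  close-push []       m = refl
  close-push (M ∷ Ms) m = cong (M ∷ₗ_) (close-push Ms m)

  push-just : ∀ (Ms : List CTerm) L → pushArgs Ms (just L) ≡ just (Ms ∷∷ L)
  push-just []       L = refl
  push-just (M ∷ Ms) L = cong (λ z → just (M ∷ₗ z)) (close-push Ms (just L))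

  ∷∷-cong : ∀ (Ms : List CTerm) {L L'} → L ⟶ₗ L' → Ms ∷∷ L ⟶ₗ Ms ∷∷ L'
  ∷∷-cong []       r = r
  ∷∷-cong (M ∷ Ms) r = cons₂ (∷∷-cong Ms r)

  ∷∷-append : ∀ (Ms : List CTerm) L l → (Ms ∷∷ L) ++ₗ l ⟶ₗ⋆ Ms ∷∷ (L ++ₗ l)
  ∷∷-append []       L l = ε
  ∷∷-append (M ∷ Ms) L l = A1 ◅ gmap (M ∷ₗ_) cons₂ (∷∷-append Ms L l)

  ∷∷-merge : ∀ (Ms : List CTerm) L → (Ms ∷∷ []ₗ) ++ₗ L ⟶ₗ⋆ Ms ∷∷ L
  ∷∷-merge Ms L = ∷∷-append Ms []ₗ L ◅◅ return (∷∷-cong Ms A2)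

  takeV-defined : ∀ k (Ms : List CTerm) → k ≤ length Ms →
                  Σ (Vec CTerm k × List CTerm) (λ p → takeV k Ms ≡ just p)
  takeV-defined zero    Ms       le       = _ , refl
  takeV-defined (suc k) (M ∷ Ms) (s≤s le) with takeV k Ms | takeV-defined k Ms le
  ... | just _ | _ , refl = _ , refl

  takeV-args : ∀ k us → k ≤ length us → takeV k (𝒜s us) ≡ nothing → ⊥
  takeV-args k us le e with takeV-defined k (𝒜s us) (Eq.subst (k ≤_) (sym length-𝒜s) le)
    where
    length-𝒜s : length (𝒜s us) ≡ length us
    length-𝒜s = trans (length-map proj₁ (args us)) (length-map arg us)
  ... | p , e' with trans (sym e') e
  ... | ()

  takeV-pointwise : ∀ {R : CTerm → CTerm → Set} k {Ms Ns} → Pointwise R Ms Ns →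
    ∀ {Vs Rs} → takeV k Ms ≡ just (Vs , Rs) →
    Σ (Vec CTerm k) λ Vs' → Σ (List CTerm) λ Rs' →
      takeV k Ns ≡ just (Vs' , Rs') × Vecʷ.Pointwise R Vs Vs' × Pointwise R Rs Rs'
  takeV-pointwise zero pw refl = _ , _ , refl , [] , pw
  takeV-pointwise (suc k) {M ∷ Ms} (r ∷ pw) e with takeV k Ms in eq
  takeV-pointwise (suc k) {M ∷ Ms} (r ∷ pw) refl | just _ with takeV-pointwise k pw eq
  ... | _ , _ , eq' , pv , pr rewrite eq' = _ , _ , refl , r ∷ pv , pr

  takeV-++ : ∀ k (Ms Ns : List CTerm) {Vs Rs} → takeV k Ms ≡ just (Vs , Rs) →
             takeV k (Ms ++ Ns) ≡ just (Vs , Rs ++ Ns)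
  takeV-++ zero    Ms       Ns refl = refl
  takeV-++ (suc k) (M ∷ Ms) Ns e with takeV k Ms in eq
  takeV-++ (suc k) (M ∷ Ms) Ns refl | just _ rewrite takeV-++ k Ms Ns eq = refl

  -- (1) The translation commutes with renaming

  renM : (ℕ → ℕ) → Maybe CLst → Maybe CLst
  renM ρ nothing  = nothing
  renM ρ (just l) = just (renL ρ l)

  Renamed : (ℕ → ℕ) → CTerm → CTerm → Set
  Renamed ρ M N = renC ρ M ≡ N

  ren-close : ∀ ρ (m : Maybe CLst) → renL ρ (close m) ≡ close (renM ρ m)
  ren-close ρ nothing  = refl
  ren-close ρ (just l) = refl

  ren-push : ∀ ρ {Ms Ns} m → Pointwise (Renamed ρ) Ms Ns →
             renM ρ (pushArgs Ms m) ≡ pushArgs Ns (renM ρ m)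
  ren-push ρ m [] = refl
  ren-push ρ {M ∷ Ms} m (r ∷ pw) =
    cong just (cong₂ _∷ₗ_ r (trans (ren-close ρ (pushArgs Ms m)) (cong close (ren-push ρ m pw))))

  ren-applyM : ∀ ρ X (p : Maybe CLst) → renC ρ (applyM X p) ≡ applyM (renC ρ X) (renM ρ p)
  ren-applyM ρ X nothing  = refl
  ren-applyM ρ X (just l) = refl

  ren-βctx : ∀ ρ X (p : Maybe CLst) → renL ρ (βctx X p) ≡ βctx (renL ρ X) (renM ρ p)
  ren-βctx ρ X nothing  = refl
  ren-βctx ρ X (just l) = refl

  renV-pointwise : ∀ ρ {n} {Vs Vs' : Vec CTerm n} → Vecʷ.Pointwise (Renamed ρ) Vs Vs' → renV ρ Vs ≡ Vs'
  renV-pointwise ρ []       = refl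
  renV-pointwise ρ (r ∷ pv) = cong₂ V._∷_ r (renV-pointwise ρ pv)

  RenOK : (ℕ → ℕ) → Term → Set
  RenOK ρ u = ∀ m → renC ρ (tr u [] m) ≡ tr (ren ρ u) [] (renM ρ m)

  renamed-args : ∀ ρ {us} → All (RenOK ρ) us → Pointwise (Renamed ρ) (𝒜s us) (𝒜s (map (ren ρ) us))
  renamed-args ρ []       = []
  renamed-args ρ (q ∷ qs) = q nothing ∷ renamed-args ρ qs

  tr-ren : ∀ (t : Term) ρ us m → ArgsOK (length us) t → All (RenOK ρ) us →
           renC ρ (tr t (args us) m) ≡ tr (ren ρ t) (args (map (ren ρ) us)) (renM ρ m)
  tr-ren (var x) ρ us m o qs =
    cong (ρ x ⟨_⟩) (trans (ren-close ρ (pushArgs (𝒜s us) m)) (cong close (ren-push ρ m (renamed-args ρ qs))))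
  tr-ren (srt s) ρ us m o qs =
    trans (ren-applyM ρ (sc s) (pushArgs (𝒜s us) m)) (cong (applyM _) (ren-push ρ m (renamed-args ρ qs)))
  tr-ren (Π T U) ρ us m (oT , oU) qs =
    trans (ren-applyM ρ (Πc (𝒜 T) (𝒜 U)) (pushArgs (𝒜s us) m))
      (cong₂ applyM (cong₂ Πc (tr-ren T ρ [] nothing oT []) (tr-ren U (extR ρ) [] nothing oU []))
                    (ren-push ρ m (renamed-args ρ qs)))
  tr-ren (ƛ T U) ρ us m (oT , oU) qs =
    trans (ren-applyM ρ (λc (𝒜 T) (𝒜 U)) (pushArgs (𝒜s us) m))
      (cong₂ applyM (cong₂ λc (tr-ren T ρ [] nothing oT []) (tr-ren U (extR ρ) [] nothing oU []))
                    (ren-push ρ m (renamed-args ρ qs)))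
  tr-ren (t · u) ρ us m (ot , ou) qs =
    tr-ren t ρ (u ∷ us) m ot ((λ m' → tr-ren u ρ [] m' ou []) ∷ qs)
  tr-ren (rα a) ρ us m o qs with takeV (arA a) (map proj₁ (args us)) in eq
  ... | nothing = ⊥-elim (takeV-args (arA a) us o eq)
  ... | just (Vs , Rs) with takeV-pointwise (arA a) (renamed-args ρ qs) eq
  ... | _ , _ , eq' , pv , pr rewrite eq' =
    trans (ren-applyM ρ (mα a Vs) (pushArgs Rs m))
          (cong₂ applyM (cong (mα a) (renV-pointwise ρ pv)) (ren-push ρ m pr))
  tr-ren (rβ b) ρ (u ∷ us) m (s≤s o) (q ∷ qs) with takeV (arB b) (map proj₁ (args us)) in eq
  ... | nothing = ⊥-elim (takeV-args (arB b) us o eq)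
  ... | just (Vs , Rs) with takeV-pointwise (arB b) (renamed-args ρ qs) eq
  ... | _ , _ , eq' , pv , pr rewrite eq' =
    trans (q (just (βctx (mβ b Vs) (pushArgs Rs m))))
      (cong (λ z → tr (ren ρ u) [] (just z))
        (trans (ren-βctx ρ (mβ b Vs) (pushArgs Rs m))
               (cong₂ βctx (cong (mβ b) (renV-pointwise ρ pv)) (ren-push ρ m pr))))

  𝒜-ren : ∀ ρ (t : Term) → PTSα t → renC ρ (𝒜 t) ≡ 𝒜 (ren ρ t)
  𝒜-ren ρ t o = tr-ren t ρ [] nothing o []

  -- (2) The translation is monotone in its context list

  applyM-ctx : ∀ X (Ms : List CTerm) {L L'} → L ⟶ₗ L' →
               applyM X (pushArgs Ms (just L)) ⟶⁺ applyM X (pushArgs Ms (just L'))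
  applyM-ctx X Ms {L} {L'} r rewrite push-just Ms L | push-just Ms L' = [ app₂ (∷∷-cong Ms r) ]⁺

  var-ctx : ∀ x (Ms : List CTerm) {L L'} → L ⟶ₗ L' →
            x ⟨ close (pushArgs Ms (just L)) ⟩ ⟶⁺ x ⟨ close (pushArgs Ms (just L')) ⟩
  var-ctx x Ms {L} {L'} r rewrite close-push Ms (just L) | close-push Ms (just L') =
    [ var₁ (∷∷-cong Ms r) ]⁺

  βctx-ctx : ∀ X (Ms : List CTerm) {L L'} → L ⟶ₗ L' →
             βctx X (pushArgs Ms (just L)) ⟶ₗ βctx X (pushArgs Ms (just L'))
  βctx-ctx X Ms {L} {L'} r rewrite push-just Ms L | push-just Ms L' = cat₂ (∷∷-cong Ms r)

  CtxOK : Term → Set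
  CtxOK u = ∀ {L L'} → L ⟶ₗ L' → 𝒜ₗ L u ⟶⁺ 𝒜ₗ L' u

  tr-ctx : ∀ (t : Term) us {L L'} → ArgsOK (length us) t → All CtxOK us → L ⟶ₗ L' →
           tr t (args us) (just L) ⟶⁺ tr t (args us) (just L')
  tr-ctx (var x) us o qs r         = var-ctx x (𝒜s us) r
  tr-ctx (srt s) us o qs r         = applyM-ctx (sc s) (𝒜s us) r
  tr-ctx (Π T U) us o qs r         = applyM-ctx (Πc (𝒜 T) (𝒜 U)) (𝒜s us) r
  tr-ctx (ƛ T U) us o qs r         = applyM-ctx (λc (𝒜 T) (𝒜 U)) (𝒜s us) r
  tr-ctx (t · u) us (ot , ou) qs r = tr-ctx t (u ∷ us) ot ((tr-ctx u [] ou []) ∷ qs) r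
  tr-ctx (rα a) us o qs r with takeV (arA a) (map proj₁ (args us)) in eq
  ... | nothing        = ⊥-elim (takeV-args (arA a) us o eq)
  ... | just (Vs , Rs) = applyM-ctx (mα a Vs) Rs r
  tr-ctx (rβ b) (u ∷ us) (s≤s o) (q ∷ qs) r with takeV (arB b) (map proj₁ (args us)) in eq
  ... | nothing        = ⊥-elim (takeV-args (arB b) us o eq)
  ... | just (Vs , Rs) = q (βctx-ctx (mβ b Vs) Rs r)

  𝒜ₗ-ctx⁺ : ∀ (t : Term) {L L'} → PTSα t → L ⟶ₗ⁺ L' → 𝒜ₗ L t ⟶⁺ 𝒜ₗ L' t
  𝒜ₗ-ctx⁺ t o [ r ]⁺   = tr-ctx t [] o [] r
  𝒜ₗ-ctx⁺ t o (r ∷ rs) = tr-ctx t [] o [] r ⁺++ 𝒜ₗ-ctx⁺ t o rs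

  𝒜ₗ-ctx⋆ : ∀ (t : Term) {L L'} → PTSα t → L ⟶ₗ⋆ L' → 𝒜ₗ L t ⟶⋆ 𝒜ₗ L' t
  𝒜ₗ-ctx⋆ t o ε        = ε
  𝒜ₗ-ctx⋆ t o (r ◅ rs) = ⁺⇒⋆ (tr-ctx t [] o [] r) ◅◅ 𝒜ₗ-ctx⋆ t o rs

  -- (3) Appending a list to the context: 𝒜ₗ L t ·ₗ l ⟶⋆ 𝒜ₗ (L ++ₗ l) t

  applyM-append : ∀ X (Ms : List CTerm) L l →
    applyM X (pushArgs Ms (just L)) ·ₗ l ⟶⋆ applyM X (pushArgs Ms (just (L ++ₗ l)))
  applyM-append X Ms L l rewrite push-just Ms L | push-just Ms (L ++ₗ l) =
    B3 ◅ gmap (X ·ₗ_) app₂ (∷∷-append Ms L l)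

  var-append : ∀ x (Ms : List CTerm) L l →
    x ⟨ close (pushArgs Ms (just L)) ⟩ ·ₗ l ⟶⋆ x ⟨ close (pushArgs Ms (just (L ++ₗ l))) ⟩
  var-append x Ms L l rewrite close-push Ms (just L) | close-push Ms (just (L ++ₗ l)) =
    B2 ◅ gmap (x ⟨_⟩) var₁ (∷∷-append Ms L l)

  βctx-append : ∀ X (Ms : List CTerm) L l →
    βctx X (pushArgs Ms (just L)) ++ₗ l ⟶ₗ⋆ βctx X (pushArgs Ms (just (L ++ₗ l)))
  βctx-append X Ms L l rewrite push-just Ms L | push-just Ms (L ++ₗ l) =
    A3 ◅ gmap (X ++ₗ_) cat₂ (∷∷-append Ms L l)

  AppendOK : Term → Set
  AppendOK u = PTSα u × (∀ L l → 𝒜ₗ L u ·ₗ l ⟶⋆ 𝒜ₗ (L ++ₗ l) u)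

  -- For β-heads the appended list enters the context of the first argument.
  tr-append : ∀ (t : Term) us L l → ArgsOK (length us) t → All AppendOK us →
              tr t (args us) (just L) ·ₗ l ⟶⋆ tr t (args us) (just (L ++ₗ l))
  tr-append (var x) us L l o qs = var-append x (𝒜s us) L l
  tr-append (srt s) us L l o qs = applyM-append (sc s) (𝒜s us) L l
  tr-append (Π T U) us L l o qs = applyM-append (Πc (𝒜 T) (𝒜 U)) (𝒜s us) L l
  tr-append (ƛ T U) us L l o qs = applyM-append (λc (𝒜 T) (𝒜 U)) (𝒜s us) L l
  tr-append (t · u) us L l (ot , ou) qs =
    tr-append t (u ∷ us) L l ot ((ou , λ L' l' → tr-append u [] L' l' ou []) ∷ qs)
  tr-append (rα a) us L l o qs with takeV (arA a) (map proj₁ (args us)) in eq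
  ... | nothing        = ⊥-elim (takeV-args (arA a) us o eq)
  ... | just (Vs , Rs) = applyM-append (mα a Vs) Rs L l
  tr-append (rβ b) (u ∷ us) L l (s≤s o) ((ou , q) ∷ qs) with takeV (arB b) (map proj₁ (args us)) in eq
  ... | nothing        = ⊥-elim (takeV-args (arB b) us o eq)
  ... | just (Vs , Rs) = q _ l ◅◅ 𝒜ₗ-ctx⋆ u ou (βctx-append (mβ b Vs) Rs L l)

  -- (4) Applying a translation to a list of translated arguments:
  --     𝒜 (t a₁ … aₙ) ·ₗ (𝒜 u₁ · … · 𝒜 uₖ · l) ⟶⋆ 𝒜ₗ l (t a₁ … aₙ u₁ … uₖ)

  applyM-apply : ∀ X (As Us : List CTerm) m →
    applyM X (pushArgs As nothing) ·ₗ close (pushArgs Us m) ⟶⋆ applyM X (pushArgs (As ++ Us) m)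
  applyM-apply X [] [] nothing  = return B1
  applyM-apply X [] [] (just l) = ε
  applyM-apply X [] (U ∷ Us) m  = ε
  applyM-apply X (A ∷ As) Us m
    rewrite close-push As nothing | close-push (As ++ Us) m | close-push Us m | ∷∷-++ As Us (close m) =
    B3 ◅ gmap (X ·ₗ_) app₂ (∷∷-merge (A ∷ As) (Us ∷∷ close m))

  var-apply : ∀ x (As Us : List CTerm) m →
    x ⟨ close (pushArgs As nothing) ⟩ ·ₗ close (pushArgs Us m) ⟶⋆ x ⟨ close (pushArgs (As ++ Us) m) ⟩
  var-apply x As Us m
    rewrite close-push As nothing | close-push Us m | close-push (As ++ Us) m | ∷∷-++ As Us (close m) =
    B2 ◅ gmap (x ⟨_⟩) var₁ (∷∷-merge As (Us ∷∷ close m))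

  βctx-apply : ∀ X (Rs Us : List CTerm) m →
    βctx X (pushArgs Rs nothing) ++ₗ close (pushArgs Us m) ⟶ₗ⋆ βctx X (pushArgs (Rs ++ Us) m)
  βctx-apply X [] [] nothing  = return A4
  βctx-apply X [] [] (just l) = ε
  βctx-apply X [] (U ∷ Us) m  = ε
  βctx-apply X (R ∷ Rs) Us m
    rewrite close-push Rs nothing | close-push (Rs ++ Us) m | close-push Us m | ∷∷-++ Rs Us (close m) =
    A3 ◅ gmap (X ++ₗ_) cat₂ (∷∷-merge (R ∷ Rs) (Us ∷∷ close m))

  tr-apply : ∀ (t : Term) as us m → ArgsOK (length as) t → All PTSα as →
             tr t (args as) nothing ·ₗ close (pushArgs (𝒜s us) m) ⟶⋆ tr t (args (as ++ us)) m
  tr-apply (var x) as us m o os rewrite 𝒜s-++ as us = var-apply x (𝒜s as) (𝒜s us) m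
  tr-apply (srt s) as us m o os rewrite 𝒜s-++ as us = applyM-apply (sc s) (𝒜s as) (𝒜s us) m
  tr-apply (Π T U) as us m o os rewrite 𝒜s-++ as us = applyM-apply (Πc (𝒜 T) (𝒜 U)) (𝒜s as) (𝒜s us) m
  tr-apply (ƛ T U) as us m o os rewrite 𝒜s-++ as us = applyM-apply (λc (𝒜 T) (𝒜 U)) (𝒜s as) (𝒜s us) m
  tr-apply (t · u) as us m (ot , ou) os = tr-apply t (u ∷ as) us m ot (ou ∷ os)
  tr-apply (rα a) as us m o os with takeV (arA a) (map proj₁ (args as)) in eq
  ... | nothing = ⊥-elim (takeV-args (arA a) as o eq)
  ... | just (Vs , Rs) rewrite 𝒜s-++ as us | takeV-++ (arA a) (𝒜s as) (𝒜s us) eq =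
    applyM-apply (mα a Vs) Rs (𝒜s us) m
  tr-apply (rβ b) (u ∷ as) us m (s≤s o) (ou ∷ os) with takeV (arB b) (map proj₁ (args as)) in eq
  ... | nothing = ⊥-elim (takeV-args (arB b) as o eq)
  ... | just (Vs , Rs) rewrite 𝒜s-++ as us | takeV-++ (arB b) (𝒜s as) (𝒜s us) eq =
    tr-append u [] _ _ ou [] ◅◅ 𝒜ₗ-ctx⋆ u ou (βctx-apply (mβ b Vs) Rs (𝒜s us) m)

  𝒜-apply : ∀ (t : Term) us m → PTSα t → 𝒜 t ·ₗ close (pushArgs (𝒜s us) m) ⟶⋆ tr t (args us) m
  𝒜-apply t us m o = tr-apply t [] us m o []

  -- (5) Explicit substitution: ⟨𝒜 w/x⟩_G 𝒜 t ⟶⋆ 𝒜 (t [ w ])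

  esubM : CTerm → CTerm → Maybe CLst → Maybe CLst
  esubM P G nothing  = nothing
  esubM P G (just l) = just (esubl P G l)

  SubstsTo : CTerm → CTerm → CTerm → CTerm → Set
  SubstsTo P G M N = esub P G M ⟶⋆ N

  esubl-push : ∀ P G {Ms Ns} m → Pointwise (SubstsTo P G) Ms Ns →
               esubl P G (close (pushArgs Ms m)) ⟶ₗ⋆ close (pushArgs Ns (esubM P G m))
  esubl-push P G nothing  [] = return D1
  esubl-push P G (just l) [] = ε
  esubl-push P G {M ∷ Ms} {N ∷ Ns} m (r ∷ pw) =
    D2 ◅ (gmap (_∷ₗ esubl P G (close (pushArgs Ms m))) cons₁ r ◅◅ gmap (N ∷ₗ_) cons₂ (esubl-push P G m pw))

  esub-applyM : ∀ P G X X' {Ms Ns} m → esub P G X ⟶⋆ X' → Pointwise (SubstsTo P G) Ms Ns →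
                esub P G (applyM X (pushArgs Ms m)) ⟶⋆ applyM X' (pushArgs Ns (esubM P G m))
  esub-applyM P G X X' nothing  rX [] = rX
  esub-applyM P G X X' (just l) rX [] = C4 ◅ gmap (_·ₗ esubl P G l) app₁ rX
  esub-applyM P G X X' {M ∷ Ms} {N ∷ Ns} m rX (r ∷ pw) =
    C4 ◅ (gmap (_·ₗ _) app₁ rX ◅◅ gmap (X' ·ₗ_) app₂ (esubl-push P G {M ∷ Ms} {N ∷ Ns} m (r ∷ pw)))

  esubl-βctx : ∀ P G X X' {Ms Ns} m → esubl P G X ⟶ₗ⋆ X' → Pointwise (SubstsTo P G) Ms Ns →
               esubl P G (βctx X (pushArgs Ms m)) ⟶ₗ⋆ βctx X' (pushArgs Ns (esubM P G m))
  esubl-βctx P G X X' nothing  rX [] = rX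
  esubl-βctx P G X X' (just l) rX [] = D3 ◅ gmap (_++ₗ esubl P G l) cat₁ rX
  esubl-βctx P G X X' {M ∷ Ms} {N ∷ Ns} m rX (r ∷ pw) =
    D3 ◅ (gmap (_++ₗ _) cat₁ rX ◅◅ gmap (X' ++ₗ_) cat₂ (esubl-push P G {M ∷ Ms} {N ∷ Ns} m (r ∷ pw)))

  esub-vec : ∀ P G {n} {Vs Vs' : Vec CTerm n} → Vecʷ.Pointwise (SubstsTo P G) Vs Vs' →
             Star _⟶ᵥ_ (V.map (esub P G) Vs) Vs'
  esub-vec P G [] = ε
  esub-vec P G {Vs = M V.∷ Ms} {N V.∷ Ns} (r ∷ pv) =
    gmap (V._∷ V.map (esub P G) Ms) here r ◅◅ gmap (N V.∷_) there (esub-vec P G pv)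

  -- The substitution lemma is proved for ρ t, as rules C1/C5 rename the body.
  substRen : (ℕ → ℕ) → Term → Term → Term
  substRen ρ w t = subst (single w) (ren ρ t)

  SubstOK : (ℕ → ℕ) → Term → CTerm → Term → Set
  SubstOK ρ w G u =
    PTSα u × (∀ m → esub (𝒜 w) G (tr (ren ρ u) [] m) ⟶⋆ tr (substRen ρ w u) [] (esubM (𝒜 w) G m))

  substituted-args : ∀ ρ w G {us} → All (SubstOK ρ w G) us →
    Pointwise (SubstsTo (𝒜 w) G) (𝒜s (map (ren ρ) us)) (𝒜s (map (substRen ρ w) us))
  substituted-args ρ w G []             = []
  substituted-args ρ w G ((_ , q) ∷ qs) = q nothing ∷ substituted-args ρ w G qs

  -- Under a binder: the induction hypothesis for the body, stated with the
  -- renaming swap₀₁ ∘ extR ρ and the weakened w, is exactly what rules C1/C5 need.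
  esub-body : ∀ ρ w G (U : Term) → PTSα w → PTSα U →
    esub (𝒜 (ren suc w)) (↑ G) (𝒜 (ren (swap₀₁ ∘ extR ρ) U)) ⟶⋆ 𝒜 (substRen (swap₀₁ ∘ extR ρ) (ren suc w) U) →
    esub (↑ (𝒜 w)) (↑ G) (swap (𝒜 (ren (extR ρ) U))) ⟶⋆ 𝒜 (subst (exts (single w)) (ren (extR ρ) U))
  esub-body ρ w G U ow oU ih =
    subst₂ _⟶⋆_
      (sym (cong₂ (λ P M → esub P (↑ G) M) (𝒜-ren suc w ow)
             (trans (𝒜-ren swap₀₁ (ren (extR ρ) U) (ArgsOK-ren (extR ρ) U oU))
                    (cong 𝒜 (ren-∘ swap₀₁ (extR ρ) U)))))
      (cong 𝒜 (subst-swap ρ w U))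
      ih

  tr-esub : ∀ (t : Term) ρ w G us m → ArgsOK (length us) t → PTSα w → All (SubstOK ρ w G) us →
    esub (𝒜 w) G (tr (ren ρ t) (args (map (ren ρ) us)) m)
      ⟶⋆ tr (substRen ρ w t) (args (map (substRen ρ w) us)) (esubM (𝒜 w) G m)
  tr-esub (var x) ρ w G us m o ow qs with ρ x
  ... | zero  =
    C2 ◅ (gmap (𝒜 w ·ₗ_) app₂ (esubl-push (𝒜 w) G m (substituted-args ρ w G qs))
          ◅◅ 𝒜-apply w (map (substRen ρ w) us) (esubM (𝒜 w) G m) ow)
  ... | suc y = C3 ◅ gmap (y ⟨_⟩) var₁ (esubl-push (𝒜 w) G m (substituted-args ρ w G qs))
  tr-esub (srt s) ρ w G us m o ow qs =
    esub-applyM (𝒜 w) G (sc s) (sc s) m (return C6) (substituted-args ρ w G qs)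
  tr-esub (Π T U) ρ w G us m (oT , oU) ow qs =
    esub-applyM (𝒜 w) G _ _ m
      (C5 ◅ (gmap (λ z → Πc z _) Πc₁ (tr-esub T ρ w G [] nothing oT ow [])
             ◅◅ gmap (Πc _) Πc₂ (esub-body ρ w G U ow oU
                  (tr-esub U (swap₀₁ ∘ extR ρ) (ren suc w) (↑ G) [] nothing oU (ArgsOK-ren suc w ow) []))))
      (substituted-args ρ w G qs)
  tr-esub (ƛ T U) ρ w G us m (oT , oU) ow qs =
    esub-applyM (𝒜 w) G _ _ m
      (C1 ◅ (gmap (λ z → λc z _) λc₁ (tr-esub T ρ w G [] nothing oT ow [])
             ◅◅ gmap (λc _) λc₂ (esub-body ρ w G U ow oU
                  (tr-esub U (swap₀₁ ∘ extR ρ) (ren suc w) (↑ G) [] nothing oU (ArgsOK-ren suc w ow) []))))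
      (substituted-args ρ w G qs)
  tr-esub (t · u) ρ w G us m (ot , ou) ow qs =
    tr-esub t ρ w G (u ∷ us) m ot ow ((ou , λ m' → tr-esub u ρ w G [] m' ou ow []) ∷ qs)
  tr-esub (rα a) ρ w G us m o ow qs with takeV (arA a) (map proj₁ (args (map (ren ρ) us))) in eq
  ... | nothing =
    ⊥-elim (takeV-args (arA a) (map (ren ρ) us) (Eq.subst (arA a ≤_) (sym (length-map (ren ρ) us)) o) eq)
  ... | just (Vs , Rs) with takeV-pointwise (arA a) (substituted-args ρ w G qs) eq
  ... | Vs' , _ , eq' , pv , pr rewrite eq' =
    esub-applyM (𝒜 w) G (mα a Vs) (mα a Vs') m (Cα ◅ gmap (mα a) mα₁ (esub-vec (𝒜 w) G pv)) pr
  tr-esub (rβ b) ρ w G (u ∷ us) m (s≤s o) ow ((ou , q) ∷ qs)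
    with takeV (arB b) (map proj₁ (args (map (ren ρ) us))) in eq
  ... | nothing =
    ⊥-elim (takeV-args (arB b) (map (ren ρ) us) (Eq.subst (arB b ≤_) (sym (length-map (ren ρ) us)) o) eq)
  ... | just (Vs , Rs) with takeV-pointwise (arB b) (substituted-args ρ w G qs) eq
  ... | Vs' , _ , eq' , pv , pr rewrite eq' =
    q (just (βctx (mβ b Vs) (pushArgs Rs m)))
    ◅◅ 𝒜ₗ-ctx⋆ (substRen ρ w u) (ArgsOK-subst (single-OK ow) (ren ρ u) (ArgsOK-ren ρ u ou))
         (esubl-βctx (𝒜 w) G (mβ b Vs) (mβ b Vs') m (Dβ ◅ gmap (mβ b) mβ₁ (esub-vec (𝒜 w) G pv)) pr)

  𝒜-esub : ∀ (t w : Term) G → PTSα t → PTSα w → esub (𝒜 w) G (𝒜 t) ⟶⋆ 𝒜 (t [ w ])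
  𝒜-esub t w G ot ow =
    subst₂ _⟶⋆_ (cong (λ z → esub (𝒜 w) G (𝒜 z)) (ren-id t)) (cong (λ z → 𝒜 (z [ w ])) (ren-id t))
      (tr-esub t (λ x → x) w G [] nothing ot ow [])

  data OneArg : List CTerm → List CTerm → Set where
    here  : ∀ {M M' Ms} → M ⟶⁺ M' → OneArg (M ∷ Ms) (M' ∷ Ms)
    there : ∀ {M Ms Ms'} → OneArg Ms Ms' → OneArg (M ∷ Ms) (M ∷ Ms')

  data OneArgᵥ : ∀ {n} → Vec CTerm n → Vec CTerm n → Set where
    here  : ∀ {n M M'} {Ms : Vec CTerm n} → M ⟶⁺ M' → OneArgᵥ (M V.∷ Ms) (M' V.∷ Ms)
    there : ∀ {n M} {Ms Ms' : Vec CTerm n} → OneArgᵥ Ms Ms' → OneArgᵥ (M V.∷ Ms) (M V.∷ Ms')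

  takeV-one : ∀ k {Ms Ns} → OneArg Ms Ns → ∀ {Vs Rs} → takeV k Ms ≡ just (Vs , Rs) →
    Σ (Vec CTerm k) λ Vs' → Σ (List CTerm) λ Rs' → takeV k Ns ≡ just (Vs' , Rs') ×
      ((OneArgᵥ Vs Vs' × Rs ≡ Rs') ⊎ (Vs ≡ Vs' × OneArg Rs Rs'))
  takeV-one zero st refl = _ , _ , refl , inj₂ (refl , st)
  takeV-one (suc k) {M ∷ Ms} (here r) e with takeV k Ms
  takeV-one (suc k) {M ∷ Ms} (here r) refl | just _ = _ , _ , refl , inj₁ (here r , refl)
  takeV-one (suc k) {M ∷ Ms} (there st) e with takeV k Ms in eq
  takeV-one (suc k) {M ∷ Ms} (there st) refl | just _ with takeV-one k st eq
  ... | _ , _ , eq' , inj₁ (ov , e') rewrite eq' = _ , _ , refl , inj₁ (there ov , e')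
  ... | _ , _ , eq' , inj₂ (e' , os) rewrite eq' = _ , _ , refl , inj₂ (cong (M V.∷_) e' , os)

  oneArgᵥ⁺ : ∀ {n} {Vs Vs' : Vec CTerm n} → OneArgᵥ Vs Vs' → TransClosure _⟶ᵥ_ Vs Vs'
  oneArgᵥ⁺ {Vs = M V.∷ Ms} (here r)   = ⁺gmap (V._∷ Ms) here r
  oneArgᵥ⁺ {Vs = M V.∷ Ms} (there st) = ⁺gmap (M V.∷_) there (oneArgᵥ⁺ st)

  close-one : ∀ {Ms Ns} m → OneArg Ms Ns → close (pushArgs Ms m) ⟶ₗ⁺ close (pushArgs Ns m)
  close-one {M ∷ Ms} m (here r)   = ⁺gmap (_∷ₗ close (pushArgs Ms m)) cons₁ r
  close-one {M ∷ Ms} m (there st) = ⁺gmap (M ∷ₗ_) cons₂ (close-one m st)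

  applyM-one : ∀ X {Ms Ns} m → OneArg Ms Ns → applyM X (pushArgs Ms m) ⟶⁺ applyM X (pushArgs Ns m)
  applyM-one X {M ∷ Ms} {N ∷ Ns} m st = ⁺gmap (X ·ₗ_) app₂ (close-one {M ∷ Ms} {N ∷ Ns} m st)

  βctx-one : ∀ X {Ms Ns} m → OneArg Ms Ns → βctx X (pushArgs Ms m) ⟶ₗ⁺ βctx X (pushArgs Ns m)
  βctx-one X {M ∷ Ms} {N ∷ Ns} m st = ⁺gmap (X ++ₗ_) cat₂ (close-one {M ∷ Ms} {N ∷ Ns} m st)

  applyM-head : ∀ {X X'} (p : Maybe CLst) → X ⟶⁺ X' → applyM X p ⟶⁺ applyM X' p
  applyM-head nothing  r = r
  applyM-head (just l) r = ⁺gmap (_·ₗ l) app₁ r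

  βctx-head : ∀ {X X'} (p : Maybe CLst) → X ⟶ₗ⁺ X' → βctx X p ⟶ₗ⁺ βctx X' p
  βctx-head nothing  r = r
  βctx-head (just l) r = ⁺gmap (_++ₗ l) cat₁ r

  data ArgStep : List Term → List Term → Set where
    here  : ∀ {u u' us} → 𝒜 u ⟶⁺ 𝒜 u' → (∀ L → 𝒜ₗ L u ⟶⁺ 𝒜ₗ L u') → ArgStep (u ∷ us) (u' ∷ us)
    there : ∀ {u us us'} → ArgStep us us' → ArgStep (u ∷ us) (u ∷ us')

  argStep-one : ∀ {us us'} → ArgStep us us' → OneArg (𝒜s us) (𝒜s us')
  argStep-one (here r _) = here r
  argStep-one (there st) = there (argStep-one st)

  tr-arg : ∀ (t : Term) us us' m → ArgsOK (length us) t → All PTSα us → ArgStep us us' →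
           tr t (args us) m ⟶⁺ tr t (args us') m
  tr-arg (var x) us us' m o os st = ⁺gmap (x ⟨_⟩) var₁ (close-one m (argStep-one st))
  tr-arg (srt s) us us' m o os st = applyM-one (sc s) m (argStep-one st)
  tr-arg (Π T U) us us' m o os st = applyM-one (Πc (𝒜 T) (𝒜 U)) m (argStep-one st)
  tr-arg (ƛ T U) us us' m o os st = applyM-one (λc (𝒜 T) (𝒜 U)) m (argStep-one st)
  tr-arg (t · u) us us' m (ot , ou) os st = tr-arg t (u ∷ us) (u ∷ us') m ot (ou ∷ os) (there st)
  tr-arg (rα a) us us' m o os st with takeV (arA a) (map proj₁ (args us)) in eq
  ... | nothing = ⊥-elim (takeV-args (arA a) us o eq)
  ... | just (Vs , Rs) with takeV-one (arA a) (argStep-one st) eq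
  ... | _ , _ , eq' , inj₁ (ov , refl) rewrite eq' =
    applyM-head (pushArgs Rs m) (⁺gmap (mα a) mα₁ (oneArgᵥ⁺ ov))
  ... | _ , _ , eq' , inj₂ (refl , ost) rewrite eq' = applyM-one (mα a Vs) m ost
  tr-arg (rβ b) (u ∷ us) (u' ∷ us) m (s≤s o) (ou ∷ os) (here r rL)
    with takeV (arB b) (map proj₁ (args us)) in eq
  ... | nothing        = ⊥-elim (takeV-args (arB b) us o eq)
  ... | just (Vs , Rs) = rL _
  tr-arg (rβ b) (u ∷ us) (u ∷ us') m (s≤s o) (ou ∷ os) (there st)
    with takeV (arB b) (map proj₁ (args us)) in eq
  ... | nothing = ⊥-elim (takeV-args (arB b) us o eq)
  ... | just (Vs , Rs) with takeV-one (arB b) (argStep-one st) eq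
  ... | _ , _ , eq' , inj₁ (ov , refl) rewrite eq' =
    𝒜ₗ-ctx⁺ u ou (βctx-head (pushArgs Rs m) (⁺gmap (mβ b) mβ₁ (oneArgᵥ⁺ ov)))
  ... | _ , _ , eq' , inj₂ (refl , ost) rewrite eq' = 𝒜ₗ-ctx⁺ u ou (βctx-one (mβ b Vs) m ost)

  -- Simulation of a β-step inside a spine

  -- The root redex: B, then the substitution lemma, then re-applying.
  tr-root-β : ∀ (v s w : Term) us m → PTSα v → PTSα s → PTSα w →
              tr (ƛ v s · w) (args us) m ⟶⁺ tr (s [ w ]) (args us) m
  tr-root-β v s w us m ov os ow =
    B ◅⁺ (gmap (_·ₗ close (pushArgs (𝒜s us) m)) app₁ (𝒜-esub s w (𝒜 v) os ow)
          ◅◅ 𝒜-apply (s [ w ]) us m (ArgsOK-subst (single-OK ow) s os))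

  -- β-steps in a spine are simulated; app₁ moves the argument into the spine,
  -- app₂ reduces an argument and needs the result for every context.
  tr-β : ∀ {t t' : Term} → t →β t' → ∀ us m → ArgsOK (length us) t → All PTSα us →
         tr t (args us) m ⟶⁺ tr t' (args us) m
  tr-β {ƛ v s · w} β us m ((ov , os) , ow) _ = tr-root-β v s w us m ov os ow
  tr-β (Π₁ r) us m (oT , oU) _ =
    applyM-head (pushArgs (𝒜s us) m) (⁺gmap (λ z → Πc z _) Πc₁ (tr-β r [] nothing oT []))
  tr-β (Π₂ r) us m (oT , oU) _ =
    applyM-head (pushArgs (𝒜s us) m) (⁺gmap (Πc _) Πc₂ (tr-β r [] nothing oU []))
  tr-β (ƛ₁ r) us m (oT , oU) _ =
    applyM-head (pushArgs (𝒜s us) m) (⁺gmap (λ z → λc z _) λc₁ (tr-β r [] nothing oT []))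
  tr-β (ƛ₂ r) us m (oT , oU) _ =
    applyM-head (pushArgs (𝒜s us) m) (⁺gmap (λc _) λc₂ (tr-β r [] nothing oU []))
  tr-β (app₁ r) us m (ot , ou) os = tr-β r (_ ∷ us) m ot (ou ∷ os)
  tr-β {t · u} {t · u'} (app₂ r) us m (ot , ou) os =
    tr-arg t (u ∷ us) (u' ∷ us) m ot (ou ∷ os)
      (here (tr-β r [] nothing ou []) (λ L → tr-β r [] (just L) ou []))

theorem2p5 : {σ : Sig} (t u : Tm {σ}) → PTSα t → PTSα u → t →β u → 𝒜 t ⟶⁺ 𝒜 u
theorem2p5 t u ot _ r = tr-β r [] nothing ot []
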